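{- There are absolute constants $c_1,c_2>0$ such that for every integer $k\ge 1$ there exists a finite family of equations $a_j x+b_jy+c_jz=0$ ($j=1,\dots,n$) with integer coefficients such that for every sufficiently large prime $p\ge p(k)$ the reduction modulo $p$ is a family $\mathcal{E}$ over $\mathbb{F}_p$ (in the sense of the context) with $\mathcal{T}_*(\mathcal{E})\ge c_1|\mathcal{E}|$ and $|\mathcal{E}|\ge k$, and there exists a set $A\subseteq\mathbb{F}_p$ avoiding $\mathcal{E}$ with $|A|\ge c_2\, p/|\mathcal{E}|^{1/2}$.
   Context: A family $\mathcal{E}$ over $\mathbb{F}_p$ consists of $n=|\mathcal{E}|$ equations $a_j x + b_j y + c_j z = d_j$ with $a_j,b_j,c_j \in \mathbb{F}_p^*$ such that no two coefficient triples are proportional. A set $A\subseteq\mathbb{F}_p$ avoids $\mathcal{E}$ if there are no $j$ and $x,y,z\in A$ with $a_jx+b_jy+c_jz=d_j$. For $k\in\{1,2,3\}$, divide each triple $(a_j,b_j,c_j)$ by its $k$-th coordinate and record the other two coordinates as a point $(u^{(k)}_j,v^{(k)}_j)$. Let $\mathcal{T}_{*,k}(\mathcal{E})$ be the maximal size of $J\subseteq\{1,\dots,n\}$ such that every $j\in J$ has $u^{(k)}_j\ne u^{(k)}_i$ for all $i\in J\setminus\{j\}$, or $v^{(k)}_j\ne v^{(k)}_i$ for all $i\in J\setminus\{j\}$, or $u^{(k)}_j/v^{(k)}_j\ne u^{(k)}_i/v^{(k)}_i$ for all $i\in J\setminus\{j\}$; and $\mathcal{T}_*(\mathcal{E})=\max_k\mathcal{T}_{*,k}(\mathcal{E})$.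 -}

module Defs where

open import Data.Nat using (ℕ; _∸_)
open import Data.Integer using (ℤ; +_; _-_; _*_; _+_; _^_)
open import Data.Integer.Divisibility using (_∣_)
open import Data.Fin using (Fin; toℕ; zero; suc)
open import Data.Fin.Subset using (Subset; _∈_)
open import Data.Product using (_×_; _,_; Σ; proj₁; proj₂)
open import Data.Sum using (_⊎_)
open import Relation.Nullary using (¬_)
open import Relation.Binary.PropositionalEquality using (_≡_; _≢_)

-- An integer coefficient triple (a , b , c) for the equation a x + b y + c z = 0.
Triple : Set
Triple = ℤ × ℤ × ℤ

fst snd thd : Triple → ℤ
fst (a , _ , _) = a
snd (_ , b , _) = b
thd (_ , _ , c) = c

_≡[_]_ : ℤ → ℕ → ℤ → Set
x ≡[ p ] y = (+ p) ∣ (x - y)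

NonZeroMod : ℕ → ℤ → Set
NonZeroMod p x = ¬ (x ≡[ p ] (+ 0))

-- Inverse in F_p (p prime), via Fermat: x⁻¹ = x^(p-2).
inv : ℕ → ℤ → ℤ
inv p x = x ^ (p ∸ 2)

divp : ℕ → ℤ → ℤ → ℤ
divp p x y = x * inv p y

Proportional : ℕ → Triple → Triple → Set
Proportional p (a , b , c) (a' , b' , c') =
  Σ ℤ λ l → NonZeroMod p l × (a' ≡[ p ] (l * a)) × (b' ≡[ p ] (l * b)) × (c' ≡[ p ] (l * c))

IsFamily : ℕ → (n : ℕ) → (Fin n → Triple) → Set
IsFamily p n E =
  ((j : Fin n) → NonZeroMod p (fst (E j)) × NonZeroMod p (snd (E j)) × NonZeroMod p (thd (E j)))
  × ((i j : Fin n) → i ≢ j → ¬ Proportional p (E i) (E j))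

-- Coordinate choice k ∈ {1,2,3} encoded as Fin 3 (zero = first coordinate).
-- Divide the triple by its k-th coordinate and record the remaining two (in order) as (u , v).
point : ℕ → Fin 3 → Triple → ℤ × ℤ
point p zero (a , b , c) = divp p b a , divp p c a
point p (suc zero) (a , b , c) = divp p a b , divp p c b
point p (suc (suc zero)) (a , b , c) = divp p a c , divp p b c

uu vv : ℕ → Fin 3 → Triple → ℤ
uu p k t = proj₁ (point p k t)
vv p k t = proj₂ (point p k t)

rr : ℕ → Fin 3 → Triple → ℤ
rr p k t = divp p (uu p k t) (vv p k t)

UniqueIn : ℕ → (n : ℕ) → Subset n → (Fin n → ℤ) → Fin n → Set
UniqueIn p n J f j = (i : Fin n) → i ∈ J → i ≢ j → ¬ (f j ≡[ p ] f i)

-- J is admissible in the definition of T_{*,k}(E).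
GoodSet : ℕ → (n : ℕ) → (Fin n → Triple) → Fin 3 → Subset n → Set
GoodSet p n E k J =
  (j : Fin n) → j ∈ J →
    UniqueIn p n J (λ i → uu p k (E i)) j
    ⊎ UniqueIn p n J (λ i → vv p k (E i)) j
    ⊎ UniqueIn p n J (λ i → rr p k (E i)) j

Avoids : (p : ℕ) → (n : ℕ) → (Fin n → Triple) → Subset p → Set
Avoids p n E A =
  (j : Fin n) → (x y z : Fin p) → x ∈ A → y ∈ A → z ∈ A →
    ¬ ((fst (E j) * + toℕ x + snd (E j) * + toℕ y + thd (E j) * + toℕ z) ≡[ p ] (+ 0))

{-# OPTIONS --safe #-}
-- For S = 2k take the equations a x + b y + z = 0 with 1 ≤ a, b ≤ S and gcd (a, b) = 1.
-- Dividing by the last coefficient, the ratio u/v of the j-th equation is a/b; by Fermat's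
-- little theorem x^(p−2) inverts x in F_p, and as a b' and a' b are below p, distinct coprime
-- pairs give distinct ratios, so the whole family is admissible for T_{*,3}. A pair that is not
-- coprime has a common divisor q ≥ 2, shared by at most (S/q)² pairs; as ∑_{q≥2} 1/q² ≤ 3/4, at
-- least S²/4 ≥ k pairs are coprime. The residues {1, …, ⌊p/(2S+2)⌋} avoid every equation, since
-- there 0 < a x + b y + z < p, and there are at least p/(8S) ≥ p/(16 √n) of them.
module Submission where

module ModularArithmetic where

  open import Defs
  open import Data.Nat as ℕ using (ℕ; zero; suc; z≤n; s≤s; _∸_; _!)
  import Data.Nat.Properties as ℕ
  import Data.Nat.Divisibility as ℕ
  open import Data.Nat.DivMod using (m/n*n≡m; m<n⇒m%n≡m)
  open import Data.Nat.Combinatorics using (_C_; nCn≡1; k>n⇒nCk≡0; nCk≡n!/k![n-k]!; k![n∸k]!∣n!; nCk+nC[k+1]≡[n+1]C[k+1])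
  open import Data.Nat.Primality using (Prime; euclidsLemma; prime⇒nonTrivial)
  open import Data.Integer as ℤ using (ℤ; +_; 0ℤ; 1ℤ; _+_; _-_; _*_; _^_; ∣_∣)
  import Data.Integer.Properties as ℤ
  import Data.Integer.Divisibility.Signed as Signed
  open import Data.Integer.Tactic.RingSolver using (solve-∀)
  open import Data.Product using (_×_; _,_)
  open import Data.Sum using (inj₁; inj₂)
  open import Relation.Nullary using (¬_; contradiction)
  open import Relation.Binary using (Setoid)
  open import Function using (_∘_)
  import Relation.Binary.Reasoning.Setoid
  open import Relation.Binary.PropositionalEquality

  module Congruence (p : ℕ) where

    -- _≡[ p ]_ wrapped in a record, so that its arguments can be inferred from its type.
    infix 4 _≈_
    record _≈_ (x y : ℤ) : Set where
      constructor ≡[]⇒≈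
      field ≈⇒≡[] : x ≡[ p ] y
    open _≈_ public

    private
      fromSigned : ∀ {x y} → + p Signed.∣ (x - y) → x ≈ y
      fromSigned = ≡[]⇒≈ ∘ Signed.∣⇒∣ᵤ

      toSigned : ∀ {x y} → x ≈ y → + p Signed.∣ (x - y)
      toSigned = Signed.∣ᵤ⇒∣ ∘ ≈⇒≡[]

    ≈-reflexive : ∀ {x y} → x ≡ y → x ≈ y
    ≈-reflexive {x} refl = fromSigned (Signed.divides 0ℤ (ℤ.+-inverseʳ x))

    ≈-sym : ∀ {x y} → x ≈ y → y ≈ x
    ≈-sym {x} {y} (≡[]⇒≈ x≡y) = ≡[]⇒≈ (subst (ℕ._∣_ p) (ℤ.∣i-j∣≡∣j-i∣ x y) x≡y)

    ≈-trans : ∀ {x y z} → x ≈ y → y ≈ z → x ≈ z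
    ≈-trans {x} {y} {z} x≈y y≈z =
      fromSigned (subst (+ p Signed.∣_) (split x y z) (Signed.∣m∣n⇒∣m+n (toSigned x≈y) (toSigned y≈z)))
      where
      split : ∀ x y z → (x - y) + (y - z) ≡ x - z
      split = solve-∀

    +-cong : ∀ {x y u v} → x ≈ y → u ≈ v → x + u ≈ y + v
    +-cong {x} {y} {u} {v} x≈y u≈v =
      fromSigned (subst (+ p Signed.∣_) (split x y u v) (Signed.∣m∣n⇒∣m+n (toSigned x≈y) (toSigned u≈v)))
      where
      split : ∀ x y u v → (x - y) + (u - v) ≡ (x + u) - (y + v)
      split = solve-∀

    +-congˡ : ∀ x {u v} → u ≈ v → x + u ≈ x + v
    +-congˡ x = +-cong (≈-reflexive {x} refl)

    *-cong : ∀ {x y u v} → x ≈ y → u ≈ v → x * u ≈ y * v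
    *-cong {x} {y} {u} {v} x≈y u≈v =
      fromSigned (subst (+ p Signed.∣_) (split x y u v)
        (Signed.∣m∣n⇒∣m+n (Signed.∣m⇒∣m*n u (toSigned x≈y)) (Signed.∣n⇒∣m*n y (toSigned u≈v))))
      where
      split : ∀ x y u v → (x - y) * u + y * (u - v) ≡ x * u - y * v
      split = solve-∀

    multiple≈0 : ∀ {n} x → p ℕ.∣ n → + n * x ≈ 0ℤ
    multiple≈0 {n} x p∣n =
      fromSigned (subst (+ p Signed.∣_) (minus-zero (+ n * x)) (Signed.∣m⇒∣m*n x (Signed.∣ᵤ⇒∣ {+ p} {+ n} p∣n)))
      where
      minus-zero : ∀ x → x ≡ x - 0ℤ
      minus-zero = solve-∀

    +≈+⇒≡ : ∀ {u v} → u ℕ.< p → v ℕ.< p → + u ≈ + v → u ≡ v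
    +≈+⇒≡ {u} {v} u<p v<p (≡[]⇒≈ p∣u-v) = ℤ.+-injective (ℤ.i-j≡0⇒i≡j (+ u) (+ v) (ℤ.∣i∣≡0⇒i≡0 ∣u-v∣≡0))
      where
      instance _ = ℕ.>-nonZero (ℕ.≤-<-trans z≤n u<p)
      ∣u-v∣<p : ∣ + u - + v ∣ ℕ.< p
      ∣u-v∣<p = ℕ.≤-<-trans (ℕ.≤-reflexive (cong ∣_∣ (ℤ.m-n≡m⊖n u v)))
                  (ℕ.≤-<-trans (ℤ.∣m⊝n∣≤m⊔n u v) (ℕ.⊔-lub u<p v<p))
      ∣u-v∣≡0 : ∣ + u - + v ∣ ≡ 0
      ∣u-v∣≡0 = trans (sym (m<n⇒m%n≡m ∣u-v∣<p)) (ℕ.n∣m⇒m%n≡0 _ p p∣u-v)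

    nonZeroMod : ∀ {v} → 0 ℕ.< v → v ℕ.< p → NonZeroMod p (+ v)
    nonZeroMod 0<v v<p v≡0 = ℕ.<⇒≢ 0<v (sym (+≈+⇒≡ v<p (ℕ.<-trans 0<v v<p) (≡[]⇒≈ v≡0)))

    ≈-setoid : Setoid _ _
    ≈-setoid = record
      { Carrier = ℤ
      ; _≈_ = _≈_
      ; isEquivalence = record { refl = ≈-reflexive refl ; sym = ≈-sym ; trans = ≈-trans }
      }

    module ≈-Reasoning = Relation.Binary.Reasoning.Setoid ≈-setoid

    proportional-lastOne : ∀ {x y x' y'} → Proportional p (x , y , 1ℤ) (x' , y' , 1ℤ) → x' ≈ x × y' ≈ y
    proportional-lastOne {x} {y} {x'} {y'} (l , _ , x'≡lx , y'≡ly , 1≡l) =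
      ≈-trans (≡[]⇒≈ {x'} {l * x} x'≡lx) (scale x) , ≈-trans (≡[]⇒≈ {y'} {l * y} y'≡ly) (scale y)
      where
      open ≈-Reasoning
      scale : ∀ z → l * z ≈ z
      scale z = begin
        l * z          ≡⟨ cong (_* z) (ℤ.*-identityʳ l) ⟨
        (l * 1ℤ) * z   ≈⟨ *-cong (≈-sym (≡[]⇒≈ {1ℤ} {l * 1ℤ} 1≡l)) (≈-reflexive {z} refl) ⟩
        1ℤ * z         ≡⟨ ℤ.*-identityˡ z ⟩
        z              ∎

  binomialSum : ℕ → ℤ → ℕ → ℤ
  binomialSum n x zero = 0ℤ
  binomialSum n x (suc m) = binomialSum n x m + + (n C m) * x ^ m

  binomialSum-pascal : ∀ n x m →
    binomialSum (suc n) x (suc m) ≡ binomialSum n x (suc m) + x * binomialSum n x m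
  binomialSum-pascal n x zero = arrange x
    where
    arrange : ∀ x → 0ℤ + 1ℤ * 1ℤ ≡ (0ℤ + 1ℤ * 1ℤ) + x * 0ℤ
    arrange = solve-∀
  binomialSum-pascal n x (suc m) = begin
    binomialSum (suc n) x (suc m) + + (suc n C suc m) * x ^ suc m
      ≡⟨ cong₂ (λ s c → s + c * x ^ suc m) (binomialSum-pascal n x m)
               (trans (cong +_ (sym (nCk+nC[k+1]≡[n+1]C[k+1] n m))) (ℤ.pos-+ (n C m) (n C suc m))) ⟩
    (binomialSum n x (suc m) + x * binomialSum n x m) + (+ (n C m) + + (n C suc m)) * (x * x ^ m)
      ≡⟨ arrange (binomialSum n x (suc m)) (binomialSum n x m) (+ (n C m)) (+ (n C suc m)) x (x ^ m) ⟩
    (binomialSum n x (suc m) + + (n C suc m) * (x * x ^ m)) + x * (binomialSum n x m + + (n C m) * x ^ m) ∎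
    where
    open ≡-Reasoning
    arrange : ∀ s₁ s₀ c₀ c₁ x y → (s₁ + x * s₀) + (c₀ + c₁) * (x * y) ≡ (s₁ + c₁ * (x * y)) + x * (s₀ + c₀ * y)
    arrange = solve-∀

  binomialSum-beyond : ∀ n x {m} → n ℕ.< m → binomialSum n x (suc m) ≡ binomialSum n x m
  binomialSum-beyond n x {m} n<m = begin
    binomialSum n x m + + (n C m) * x ^ m ≡⟨ cong (λ c → binomialSum n x m + + c * x ^ m) (k>n⇒nCk≡0 n<m) ⟩
    binomialSum n x m + 0ℤ                ≡⟨ ℤ.+-identityʳ _ ⟩
    binomialSum n x m                     ∎
    where open ≡-Reasoning

  binomial-theorem : ∀ n x → (1ℤ + x) ^ n ≡ binomialSum n x (suc n)
  binomial-theorem zero x = refl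
  binomial-theorem (suc n) x = begin
    (1ℤ + x) * (1ℤ + x) ^ n                                ≡⟨ cong ((1ℤ + x) *_) (binomial-theorem n x) ⟩
    (1ℤ + x) * binomialSum n x (suc n)                     ≡⟨ distrib x (binomialSum n x (suc n)) ⟩
    binomialSum n x (suc n) + x * binomialSum n x (suc n)  ≡⟨ cong (_+ x * binomialSum n x (suc n)) (binomialSum-beyond n x (ℕ.n<1+n n)) ⟨
    binomialSum n x (2 ℕ.+ n) + x * binomialSum n x (suc n) ≡⟨ binomialSum-pascal n x (suc n) ⟨
    binomialSum (suc n) x (2 ℕ.+ n)                        ∎
    where
    open ≡-Reasoning
    distrib : ∀ x s → (1ℤ + x) * s ≡ s + x * s
    distrib = solve-∀

  prime∤m! : ∀ {p m} → Prime p → m ℕ.< p → ¬ (p ℕ.∣ m !)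
  prime∤m! {p} {zero} pr _ = ℕ.>⇒∤ (ℕ.nonTrivial⇒n>1 p {{prime⇒nonTrivial pr}})
  prime∤m! {p} {suc m} pr m<p p∣m! with euclidsLemma (suc m) (m !) pr p∣m!
  ... | inj₁ p∣1+m = ℕ.>⇒∤ m<p p∣1+m
  ... | inj₂ p∣m!  = prime∤m! pr (ℕ.<-trans (ℕ.n<1+n m) m<p) p∣m!

  -- p divides p! = (p C k) · k! · (p − k)! but neither of the two factorials.
  prime∣pCk : ∀ {p k} → Prime p → 0 ℕ.< k → k ℕ.< p → p ℕ.∣ p C k
  prime∣pCk {p@(suc q)} {k} pr 0<k k<p
    with euclidsLemma (p C k) (k ! ℕ.* (p ∸ k) !) pr (subst (p ℕ.∣_) (sym factorials) (ℕ.m∣m*n (q !)))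
    where
    factorials : (p C k) ℕ.* (k ! ℕ.* (p ∸ k) !) ≡ p !
    factorials = begin
      (p C k) ℕ.* (k ! ℕ.* (p ∸ k) !)            ≡⟨ cong (ℕ._* (k ! ℕ.* (p ∸ k) !)) (nCk≡n!/k![n-k]! (ℕ.<⇒≤ k<p)) ⟩
      p ! ℕ./ (k ! ℕ.* (p ∸ k) !) ℕ.* (k ! ℕ.* (p ∸ k) !) ≡⟨ m/n*n≡m (k![n∸k]!∣n! (ℕ.<⇒≤ k<p)) ⟩
      p !                                        ∎
      where
      open ≡-Reasoning
      instance _ = ℕ.m*n≢0 (k !) ((p ∸ k) !) {{k ℕ.!≢0}} {{(p ∸ k) ℕ.!≢0}}
  ... | inj₁ p∣pCk = p∣pCk
  ... | inj₂ p∣k![p-k]! with euclidsLemma (k !) ((p ∸ k) !) pr p∣k![p-k]!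
  ...   | inj₁ p∣k! = contradiction p∣k! (prime∤m! pr k<p)
  ...   | inj₂ p∣[p-k]! = contradiction p∣[p-k]! (prime∤m! pr (ℕ.∸-monoʳ-< 0<k (ℕ.<⇒≤ k<p)))

  module _ {p : ℕ} (pr : Prime p) where

    open Congruence p
    open ≈-Reasoning

    private
      1<p : 1 ℕ.< p
      1<p = ℕ.nonTrivial⇒n>1 p {{prime⇒nonTrivial pr}}

    binomialSum-prime≈1 : ∀ x m → 1 ℕ.≤ m → m ℕ.≤ p → binomialSum p x m ≈ 1ℤ
    binomialSum-prime≈1 x (suc zero) _ _ = ≈-reflexive refl
    binomialSum-prime≈1 x (suc (suc m)) _ 2+m≤p = begin
      binomialSum p x (suc m) + + (p C suc m) * x ^ suc m
        ≈⟨ +-cong (binomialSum-prime≈1 x (suc m) (s≤s z≤n) (ℕ.<⇒≤ 2+m≤p))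
                  (multiple≈0 (x ^ suc m) (prime∣pCk pr (s≤s z≤n) 2+m≤p)) ⟩
      1ℤ + 0ℤ ∎

    freshmans-dream : ∀ x → (1ℤ + x) ^ p ≈ 1ℤ + x ^ p
    freshmans-dream x = begin
      (1ℤ + x) ^ p                           ≡⟨ binomial-theorem p x ⟩
      binomialSum p x p + + (p C p) * x ^ p   ≈⟨ +-cong (binomialSum-prime≈1 x p (ℕ.<⇒≤ 1<p) ℕ.≤-refl) (≈-reflexive refl) ⟩
      1ℤ + + (p C p) * x ^ p                 ≡⟨ cong (λ c → 1ℤ + + c * x ^ p) (nCn≡1 p) ⟩
      1ℤ + 1ℤ * x ^ p                        ≡⟨ cong (λ y → 1ℤ + y) (ℤ.*-identityˡ (x ^ p)) ⟩
      1ℤ + x ^ p                             ∎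

    fermat-little : ∀ a → (+ suc a) ^ p ≈ + suc a
    fermat-little zero = ≈-reflexive (ℤ.^-zeroˡ p)
    fermat-little (suc a) = begin
      (1ℤ + + suc a) ^ p  ≈⟨ freshmans-dream (+ suc a) ⟩
      1ℤ + (+ suc a) ^ p  ≈⟨ +-congˡ 1ℤ (fermat-little a) ⟩
      1ℤ + + suc a        ∎

    *-cancelˡ-≈ : ∀ c {x y} → NonZeroMod p c → c * x ≈ c * y → x ≈ y
    *-cancelˡ-≈ c {x} {y} c≢0 (≡[]⇒≈ p∣cx-cy)
      with euclidsLemma ∣ c ∣ ∣ x - y ∣ pr (subst (p ℕ.∣_) (trans (cong ∣_∣ (factor c x y)) (ℤ.abs-* c (x - y))) p∣cx-cy)
      where
      factor : ∀ c x y → c * x - c * y ≡ c * (x - y)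
      factor = solve-∀
    ... | inj₁ p∣c   = contradiction (subst (p ℕ.∣_) (cong ∣_∣ (sym (ℤ.+-identityʳ c))) p∣c) c≢0
    ... | inj₂ p∣x-y = ≡[]⇒≈ p∣x-y

    inv-inverse : ∀ {b} → NonZeroMod p (+ b) → + b * inv p (+ b) ≈ 1ℤ
    inv-inverse {zero} b≢0 = contradiction (≈⇒≡[] (≈-reflexive {+ 0} refl)) b≢0
    inv-inverse {suc a} b≢0 = *-cancelˡ-≈ (+ suc a) b≢0 (begin
      + suc a * (+ suc a * inv p (+ suc a)) ≡⟨ cong ((+ suc a) ^_) (ℕ.m+[n∸m]≡n {2} {p} 1<p) ⟩
      (+ suc a) ^ p                         ≈⟨ fermat-little a ⟩
      + suc a                               ≡⟨ ℤ.*-identityʳ (+ suc a) ⟨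
      + suc a * 1ℤ                          ∎)

    divp≈divp⇒cross≈ : ∀ {a a' b b'} → NonZeroMod p (+ b) → NonZeroMod p (+ b') →
      divp p a (+ b) ≈ divp p a' (+ b') → a * + b' ≈ a' * + b
    divp≈divp⇒cross≈ {a} {a'} {b} {b'} b≢0 b'≢0 a/b≈a'/b' = begin
      a * + b'                                 ≡⟨ ℤ.*-identityʳ (a * + b') ⟨
      (a * + b') * 1ℤ                          ≈⟨ *-cong (≈-reflexive {a * + b'} refl) (≈-sym (inv-inverse b≢0)) ⟩
      (a * + b') * (+ b * inv p (+ b))         ≡⟨ arrange a (+ b') (+ b) (inv p (+ b)) ⟩
      divp p a (+ b) * (+ b * + b')            ≈⟨ *-cong a/b≈a'/b' (≈-reflexive refl) ⟩
      divp p a' (+ b') * (+ b * + b')          ≡⟨ arrange' a' (+ b') (+ b) (inv p (+ b')) ⟩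
      (a' * + b) * (+ b' * inv p (+ b'))       ≈⟨ *-cong (≈-reflexive {a' * + b} refl) (inv-inverse b'≢0) ⟩
      (a' * + b) * 1ℤ                          ≡⟨ ℤ.*-identityʳ (a' * + b) ⟩
      a' * + b                                 ∎
      where
      arrange : ∀ a b' b i → (a * b') * (b * i) ≡ (a * i) * (b * b')
      arrange = solve-∀
      arrange' : ∀ a' b' b i → (a' * i) * (b * b') ≡ (a' * b) * (b' * i)
      arrange' = solve-∀


module CoprimePairs where

  open import Data.Nat using (ℕ; zero; suc; s≤s⁻¹; _+_; _*_; _∸_; _≤_; _<_; z≤n; s≤s; >-nonZero)
  open import Data.Nat.Properties
  open import Data.Nat.Divisibility using (_∣_; _∣?_; ∣⇒≤; ∣m+n∣m⇒∣n; m∣m*n; 0∣⇒≡0)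
  open import Data.Nat.GCD using (gcd; gcd[m,n]∣m; gcd[m,n]∣n)
  open import Data.Nat.Coprimality using (Coprime; coprime?; gcd≡1⇒coprime)
  open import Data.Nat.Tactic.RingSolver using (solve-∀)
  open import Data.List using (List; []; _∷_; _++_; map; filter; length; cartesianProduct; applyDownFrom)
  open import Data.List.Properties using (filter-accept; filter-reject; filter-++; length-++; length-map; length-applyDownFrom)
  open import Data.List.Relation.Unary.All as All using (All; []; _∷_)
  open import Data.List.Relation.Unary.All.Properties using (cartesianProduct⁺; applyDownFrom⁺₁)
  open import Data.Product using (∃-syntax; _×_; _,_; proj₁; proj₂; uncurry)
  open import Data.Sum using (inj₁; inj₂)
  open import Relation.Nullary using (¬_; Dec; yes; no; contradiction)
  open import Relation.Nullary.Decidable using (¬?)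
  open import Relation.Unary.Properties using (_×?_)
  open import Function using (_∘_)
  open import Relation.Unary using (Pred; Decidable; _⟨×⟩_)
  open import Level using (0ℓ)
  open import Data.Empty using (⊥-elim)
  open import Relation.Binary.PropositionalEquality

  sumBelow : ℕ → (ℕ → ℕ) → ℕ
  sumBelow zero f = 0
  sumBelow (suc T) f = sumBelow T f + f T

  sumBelow-cong : ∀ {f g : ℕ → ℕ} → (∀ t → f t ≡ g t) → ∀ T → sumBelow T f ≡ sumBelow T g
  sumBelow-cong f≗g zero = refl
  sumBelow-cong f≗g (suc T) = cong₂ _+_ (sumBelow-cong f≗g T) (f≗g T)

  module _ {f g : ℕ → ℕ} (f≤g : ∀ t → f t ≤ g t) where

    sumBelow-mono-≤ : ∀ T → sumBelow T f ≤ sumBelow T g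
    sumBelow-mono-≤ zero = z≤n
    sumBelow-mono-≤ (suc T) = +-mono-≤ (sumBelow-mono-≤ T) (f≤g T)

    sumBelow-mono-< : ∀ {t T} → t < T → f t < g t → sumBelow T f < sumBelow T g
    sumBelow-mono-< {t} {suc T} t<1+T ft<gt with m≤n⇒m<n∨m≡n (s≤s⁻¹ t<1+T)
    ... | inj₁ t<T = +-mono-<-≤ (sumBelow-mono-< t<T ft<gt) (f≤g T)
    ... | inj₂ refl = +-mono-≤-< (sumBelow-mono-≤ T) ft<gt

  module _ {a} {A : Set a} {P : Pred A a} (P? : Decidable P) where

    length-filter-∷-≤ : ∀ x xs → length (filter P? xs) ≤ length (filter P? (x ∷ xs))
    length-filter-∷-≤ x xs with P? x
    ... | yes _ = n≤1+n _
    ... | no _ = ≤-refl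

    length-filter-∷-< : ∀ {x} xs → P x → length (filter P? xs) < length (filter P? (x ∷ xs))
    length-filter-∷-< xs Px = ≤-reflexive (cong length (sym (filter-accept P? Px)))

    length-filter-+-filter-¬ : ∀ xs → length (filter P? xs) + length (filter (¬? ∘ P?) xs) ≡ length xs
    length-filter-+-filter-¬ [] = refl
    length-filter-+-filter-¬ (x ∷ xs) with P? x
    ... | yes _ = cong suc (length-filter-+-filter-¬ xs)
    ... | no _  = trans (+-suc _ _) (cong suc (length-filter-+-filter-¬ xs))

  module _ {a} {A : Set a} {P : Pred A a} (P? : Decidable P)
           {Q : ℕ → Pred A a} (Q? : ∀ t → Decidable (Q t)) (T : ℕ) where

    length-filter-≤-sumBelow : ∀ xs → All (λ x → P x → ∃[ t ] t < T × Q t x) xs →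
      length (filter P? xs) ≤ sumBelow T (λ t → length (filter (Q? t) xs))
    length-filter-≤-sumBelow [] _ = z≤n
    length-filter-≤-sumBelow (x ∷ xs) (cover ∷ covers) with P? x
    ... | no ¬Px = ≤-trans (length-filter-≤-sumBelow xs covers)
                     (sumBelow-mono-≤ (λ t → length-filter-∷-≤ (Q? t) x xs) T)
    ... | yes Px with cover Px
    ...   | t , t<T , Qtx = ≤-<-trans (length-filter-≤-sumBelow xs covers)
                              (sumBelow-mono-< (λ t → length-filter-∷-≤ (Q? t) x xs) t<T
                                (length-filter-∷-< (Q? t) xs Qtx))

  module _ {Z : ℕ} (h : ℕ → ℕ) (bound : ∀ t → (2 + t) * (2 + t) * h t ≤ Z) where

    -- ∑_{2 ≤ q ≤ N+2} 1/q² ≤ 3/4 − 1/(N+2), since 1/q² ≤ 1/(q−1) − 1/q.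
    private
      telescope : ∀ N → 4 * (2 + N) * sumBelow (suc N) h + 4 * Z ≤ 3 * (2 + N) * Z
      telescope zero = begin
        4 * 2 * (0 + h 0) + 4 * Z ≡⟨ e₁ (h 0) Z ⟩
        2 * (2 * 2 * h 0) + 4 * Z ≤⟨ +-monoˡ-≤ (4 * Z) (*-monoʳ-≤ 2 (bound 0)) ⟩
        2 * Z + 4 * Z             ≡⟨ e₂ Z ⟩
        3 * 2 * Z                 ∎
        where
        open ≤-Reasoning
        e₁ : ∀ x Z → 4 * 2 * (0 + x) + 4 * Z ≡ 2 * (2 * 2 * x) + 4 * Z
        e₁ = solve-∀
        e₂ : ∀ Z → 2 * Z + 4 * Z ≡ 3 * 2 * Z
        e₂ = solve-∀
      telescope (suc N) = *-cancelˡ-≤ (2 + N) (+-cancelʳ-≤ (4 * (3 + N) * Z) _ _ (begin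
        (2 + N) * (4 * (3 + N) * (S + x) + 4 * Z) + 4 * (3 + N) * Z
          ≡⟨ e₁ N S x Z ⟩
        (3 + N) * (4 * (2 + N) * S + 4 * Z) + 4 * ((2 + N) * (3 + N) * x) + 4 * (2 + N) * Z
          ≤⟨ +-monoˡ-≤ _ (+-mono-≤ (*-monoʳ-≤ (3 + N) (telescope N)) (*-monoʳ-≤ 4 x-bound)) ⟩
        (3 + N) * (3 * (2 + N) * Z) + 4 * Z + 4 * (2 + N) * Z
          ≡⟨ e₂ N Z ⟩
        (2 + N) * (3 * (3 + N) * Z) + 4 * (3 + N) * Z ∎))
        where
        open ≤-Reasoning
        S x : ℕ
        S = sumBelow (suc N) h
        x = h (suc N)
        x-bound : (2 + N) * (3 + N) * x ≤ Z
        x-bound = ≤-trans (*-monoˡ-≤ x (*-monoˡ-≤ (3 + N) (n≤1+n (2 + N)))) (bound (suc N))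
        e₁ : ∀ N S x Z → (2 + N) * (4 * (3 + N) * (S + x) + 4 * Z) + 4 * (3 + N) * Z
                       ≡ (3 + N) * (4 * (2 + N) * S + 4 * Z) + 4 * ((2 + N) * (3 + N) * x) + 4 * (2 + N) * Z
        e₁ = solve-∀
        e₂ : ∀ N Z → (3 + N) * (3 * (2 + N) * Z) + 4 * Z + 4 * (2 + N) * Z
                   ≡ (2 + N) * (3 * (3 + N) * Z) + 4 * (3 + N) * Z
        e₂ = solve-∀

    sumBelow-inverseSquares : ∀ T → 4 * sumBelow T h ≤ 3 * Z
    sumBelow-inverseSquares zero = z≤n
    sumBelow-inverseSquares (suc N) = *-cancelˡ-≤ (2 + N) (begin
      (2 + N) * (4 * S)   ≡⟨ e₁ N S ⟩
      4 * (2 + N) * S     ≤⟨ m+n≤o⇒m≤o _ (telescope N) ⟩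
      3 * (2 + N) * Z     ≡⟨ e₂ N Z ⟩
      (2 + N) * (3 * Z)   ∎)
      where
      open ≤-Reasoning
      S : ℕ
      S = sumBelow (suc N) h
      e₁ : ∀ N S → (2 + N) * (4 * S) ≡ 4 * (2 + N) * S
      e₁ = solve-∀
      e₂ : ∀ N Z → 3 * (2 + N) * Z ≡ (2 + N) * (3 * Z)
      e₂ = solve-∀

  +-divisor-≤ : ∀ {d m n} → d ∣ m → d ∣ n → m < n → m + d ≤ n
  +-divisor-≤ {d} {m} {n} d∣m d∣n m<n = begin
    m + d        ≤⟨ +-monoʳ-≤ m (∣⇒≤ {{>-nonZero (m<n⇒0<n∸m m<n)}} d∣n∸m) ⟩
    m + (n ∸ m)  ≡⟨ m+[n∸m]≡n (<⇒≤ m<n) ⟩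
    n            ∎
    where
    open ≤-Reasoning
    d∣n∸m : d ∣ n ∸ m
    d∣n∸m = ∣m+n∣m⇒∣n (subst (d ∣_) (sym (m+[n∸m]≡n (<⇒≤ m<n))) d∣n) d∣m

  *-length-multiples-≤ : ∀ q S → q * length (filter (q ∣?_) (applyDownFrom suc S)) ≤ S
  *-length-multiples-≤ q zero = ≤-reflexive (*-zeroʳ q)
  *-length-multiples-≤ q (suc S) with q ∣? suc S
  ... | no _ = m≤n⇒m≤1+n (*-length-multiples-≤ q S)
  ... | yes q∣1+S = begin
    q * suc c  ≡⟨ *-suc q c ⟩
    q + q * c  ≡⟨ +-comm q (q * c) ⟩
    q * c + q  ≤⟨ +-divisor-≤ (m∣m*n c) q∣1+S (s≤s (*-length-multiples-≤ q S)) ⟩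
    suc S      ∎
    where
    open ≤-Reasoning
    c : ℕ
    c = length (filter (q ∣?_) (applyDownFrom suc S))

  module _ {a} {A B : Set a} {P : Pred A a} {Q : Pred B a} (P? : Decidable P) (Q? : Decidable Q) where

    private
      length-filter-map-accept : ∀ {x} → P x → ∀ ys → length (filter (P? ×? Q?) (map (x ,_) ys)) ≡ length (filter Q? ys)
      length-filter-map-accept Px [] = refl
      length-filter-map-accept {x} Px (y ∷ ys) = by-cases (Q? y)
        where
        open ≡-Reasoning
        rest : length (filter (P? ×? Q?) (map (x ,_) ys)) ≡ length (filter Q? ys)
        rest = length-filter-map-accept Px ys
        by-cases : Dec (Q y) → length (filter (P? ×? Q?) (map (x ,_) (y ∷ ys))) ≡ length (filter Q? (y ∷ ys))
        by-cases (yes Qy) = begin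
          length (filter (P? ×? Q?) ((x , y) ∷ map (x ,_) ys)) ≡⟨ cong length (filter-accept (P? ×? Q?) (Px , Qy)) ⟩
          suc (length (filter (P? ×? Q?) (map (x ,_) ys)))   ≡⟨ cong suc rest ⟩
          suc (length (filter Q? ys))                        ≡⟨ cong length (filter-accept Q? Qy) ⟨
          length (filter Q? (y ∷ ys))                        ∎
        by-cases (no ¬Qy) = begin
          length (filter (P? ×? Q?) ((x , y) ∷ map (x ,_) ys)) ≡⟨ cong length (filter-reject (P? ×? Q?) (¬Qy ∘ proj₂)) ⟩
          length (filter (P? ×? Q?) (map (x ,_) ys))         ≡⟨ rest ⟩
          length (filter Q? ys)                              ≡⟨ cong length (filter-reject Q? ¬Qy) ⟨
          length (filter Q? (y ∷ ys))                        ∎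

      length-filter-map-reject : ∀ {x} → ¬ P x → ∀ ys → length (filter (P? ×? Q?) (map (x ,_) ys)) ≡ 0
      length-filter-map-reject ¬Px [] = refl
      length-filter-map-reject ¬Px (y ∷ ys) =
        trans (cong length (filter-reject (P? ×? Q?) (¬Px ∘ proj₁))) (length-filter-map-reject ¬Px ys)

    length-filter-cartesianProduct : ∀ xs ys →
      length (filter (P? ×? Q?) (cartesianProduct xs ys)) ≡ length (filter P? xs) * length (filter Q? ys)
    length-filter-cartesianProduct [] ys = refl
    length-filter-cartesianProduct (x ∷ xs) ys = begin
      length (filter R (map (x ,_) ys ++ cartesianProduct xs ys))
        ≡⟨ cong length (filter-++ R (map (x ,_) ys) (cartesianProduct xs ys)) ⟩
      length (filter R (map (x ,_) ys) ++ filter R (cartesianProduct xs ys))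
        ≡⟨ length-++ (filter R (map (x ,_) ys)) ⟩
      length (filter R (map (x ,_) ys)) + length (filter R (cartesianProduct xs ys))
        ≡⟨ cong (length (filter R (map (x ,_) ys)) +_) (length-filter-cartesianProduct xs ys) ⟩
      length (filter R (map (x ,_) ys)) + length (filter P? xs) * L
        ≡⟨ first-row (P? x) ⟩
      length (filter P? (x ∷ xs)) * L ∎
      where
      open ≡-Reasoning
      R : Decidable (P ⟨×⟩ Q)
      R = P? ×? Q?
      L : ℕ
      L = length (filter Q? ys)
      first-row : Dec (P x) → length (filter R (map (x ,_) ys)) + length (filter P? xs) * L ≡ length (filter P? (x ∷ xs)) * L
      first-row (yes Px) = trans (cong (_+ length (filter P? xs) * L) (length-filter-map-accept Px ys))
                                 (cong (λ zs → length zs * L) (sym (filter-accept P? Px)))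
      first-row (no ¬Px) = trans (cong (_+ length (filter P? xs) * L) (length-filter-map-reject ¬Px ys))
                                 (cong (λ zs → length zs * L) (sym (filter-reject P? ¬Px)))

  length-cartesianProduct : ∀ {a} {A B : Set a} (xs : List A) (ys : List B) →
    length (cartesianProduct xs ys) ≡ length xs * length ys
  length-cartesianProduct [] ys = refl
  length-cartesianProduct (x ∷ xs) ys =
    trans (length-++ (map (x ,_) ys)) (cong₂ _+_ (length-map (x ,_) ys) (length-cartesianProduct xs ys))

  ¬coprime⇒common-divisor : ∀ {a b} → 0 < a → ¬ Coprime a b → ∃[ t ] 2 + t ≤ a × 2 + t ∣ a × 2 + t ∣ b
  ¬coprime⇒common-divisor {a} {b} 0<a ¬coprime
    with gcd a b in gcd≡ | gcd[m,n]∣m a b | gcd[m,n]∣n a b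
  ... | zero        | 0∣a | _   = contradiction (0∣⇒≡0 0∣a) (>⇒≢ 0<a)
  ... | suc zero    | _   | _   = ⊥-elim (¬coprime (gcd≡1⇒coprime gcd≡))
  ... | suc (suc t) | d∣a | d∣b = t , ∣⇒≤ {{>-nonZero 0<a}} d∣a , d∣a , d∣b

  boundedPairs : ℕ → List (ℕ × ℕ)
  boundedPairs S = cartesianProduct (applyDownFrom suc S) (applyDownFrom suc S)

  coprimePairs : ℕ → List (ℕ × ℕ)
  coprimePairs S = filter (uncurry coprime?) (boundedPairs S)

  InRange : ℕ → Pred ℕ 0ℓ
  InRange S a = 0 < a × a ≤ S

  boundedPairs-inRange : ∀ S → All (InRange S ⟨×⟩ InRange S) (boundedPairs S)
  boundedPairs-inRange S = cartesianProduct⁺ (setoid ℕ) (setoid ℕ) _ _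
    (λ a∈ b∈ → All.lookup inRange a∈ , All.lookup inRange b∈)
    where
    inRange : All (InRange S) (applyDownFrom suc S)
    inRange = applyDownFrom⁺₁ suc S (λ i<S → s≤s z≤n , i<S)

  CommonDivisor : ℕ → Pred (ℕ × ℕ) 0ℓ
  CommonDivisor q = (q ∣_) ⟨×⟩ (q ∣_)

  commonDivisor? : ∀ q → Decidable (CommonDivisor q)
  commonDivisor? q = (q ∣?_) ×? (q ∣?_)

  boundedPairs-¬coprime : ∀ S → All (λ x → ¬ uncurry Coprime x → ∃[ t ] t < S × CommonDivisor (2 + t) x) (boundedPairs S)
  boundedPairs-¬coprime S = All.map (λ { ((0<a , a≤S) , _) ¬coprime → cover 0<a a≤S ¬coprime }) (boundedPairs-inRange S)
    where
    cover : ∀ {a b} → 0 < a → a ≤ S → ¬ Coprime a b → ∃[ t ] t < S × CommonDivisor (2 + t) (a , b)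
    cover 0<a a≤S ¬coprime with ¬coprime⇒common-divisor 0<a ¬coprime
    ... | t , 2+t≤a , d∣a , d∣b = t , ≤-trans (n≤1+n (suc t)) (≤-trans 2+t≤a a≤S) , d∣a , d∣b

  length-¬coprimePairs : ∀ S → 4 * length (filter (¬? ∘ uncurry coprime?) (boundedPairs S)) ≤ 3 * (S * S)
  length-¬coprimePairs S = begin
    4 * length (filter (¬? ∘ uncurry coprime?) (boundedPairs S))
      ≤⟨ *-monoʳ-≤ 4 (length-filter-≤-sumBelow (¬? ∘ uncurry coprime?) (λ t → commonDivisor? (2 + t)) S
                        (boundedPairs S) (boundedPairs-¬coprime S)) ⟩
    4 * sumBelow S (λ t → length (filter (commonDivisor? (2 + t)) (boundedPairs S)))
      ≡⟨ cong (4 *_) (sumBelow-cong (λ t → length-filter-cartesianProduct (2 + t ∣?_) (2 + t ∣?_) oneToS oneToS) S) ⟩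
    4 * sumBelow S (λ t → multiples t * multiples t)
      ≤⟨ sumBelow-inverseSquares (λ t → multiples t * multiples t) squares S ⟩
    3 * (S * S) ∎
    where
    open ≤-Reasoning
    oneToS : List ℕ
    oneToS = applyDownFrom suc S
    multiples : ℕ → ℕ
    multiples t = length (filter (2 + t ∣?_) oneToS)
    squares : ∀ t → (2 + t) * (2 + t) * (multiples t * multiples t) ≤ S * S
    squares t = subst (_≤ S * S) (rearrange (2 + t) (multiples t)) (*-mono-≤ qm≤S qm≤S)
      where
      qm≤S : (2 + t) * multiples t ≤ S
      qm≤S = *-length-multiples-≤ (2 + t) S
      rearrange : ∀ q m → q * m * (q * m) ≡ q * q * (m * m)
      rearrange = solve-∀

  length-coprimePairs : ∀ S → S * S ≤ 4 * length (coprimePairs S)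
  length-coprimePairs S = +-cancelʳ-≤ (3 * (S * S)) _ _ (begin
    S * S + 3 * (S * S)  ≡⟨⟩
    4 * (S * S)          ≡⟨ cong (4 *_) split ⟨
    4 * (C + N)          ≡⟨ *-distribˡ-+ 4 C N ⟩
    4 * C + 4 * N        ≤⟨ +-monoʳ-≤ (4 * C) (length-¬coprimePairs S) ⟩
    4 * C + 3 * (S * S)  ∎)
    where
    open ≤-Reasoning
    C N : ℕ
    C = length (coprimePairs S)
    N = length (filter (¬? ∘ uncurry coprime?) (boundedPairs S))
    split : C + N ≡ S * S
    split = trans (length-filter-+-filter-¬ (uncurry coprime?) (boundedPairs S))
           (trans (length-cartesianProduct (applyDownFrom suc S) (applyDownFrom suc S))
                  (cong₂ _*_ (length-applyDownFrom suc S) (length-applyDownFrom suc S)))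

module Construction where

  open import Defs
  open import Data.Nat as ℕ using (ℕ; zero; suc; z≤n; s≤s; _≥_; _≤_; _<_; >-nonZero)
  import Data.Nat.Properties as ℕ
  open import Data.Nat.Divisibility using (_∣_; divides; ∣-antisym)
  open import Data.Nat.DivMod using (_/_; _%_; m/n*n≤m; m%n<n; m≡m%n+[m/n]*n; m≥n⇒m/n>0)
  open import Data.Nat.Coprimality using (Coprime; coprime?; coprime-divisor)
  open import Data.Nat.Primality using (Prime; prime⇒nonTrivial)
  open import Data.Nat.Tactic.RingSolver using (solve-∀)
  open import Data.Integer as ℤ using (ℤ; +_; 1ℤ; _*_; _+_)
  import Data.Integer.Properties as ℤ
  import Data.Integer.Tactic.RingSolver as ℤ
  open import Data.Rational as ℚ using (ℚ; toℚᵘ)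
  open import Data.Rational.Properties using (toℚᵘ-cancel-≤; toℚᵘ-homo-*; toℚᵘ-fromℚᵘ)
  open import Data.Rational.Unnormalised as ℚᵘ using (ℚᵘ; mkℚᵘ; *≤*)
  import Data.Rational.Unnormalised.Properties as ℚᵘ
  open import Data.Fin using (Fin; zero; suc; toℕ)
  open import Data.Fin.Subset using (Subset; _∈_; ⊤; ⊥; inside; outside; ∣_∣)
  open import Data.Fin.Subset.Properties using (∉⊥; ∣⊥∣≡0)
  open import Data.Vec using ([]; _∷_; here; there)
  open import Data.List using (List; []; _∷_; length; lookup; applyDownFrom)
  open import Data.List.Membership.Propositional.Properties using (∈-lookup)
  open import Data.List.Relation.Unary.All as All using (All)
  import Data.List.Relation.Unary.All.Properties as All
  open import Data.List.Relation.Unary.Unique.Propositional using (Unique; []; _∷_)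
  import Data.List.Relation.Unary.Unique.Propositional.Properties as Unique
  open import Data.Product using (Σ; _×_; _,_; proj₁; proj₂; uncurry)
  open import Data.Sum using (inj₂)
  open import Relation.Nullary using (¬_; contradiction)
  open import Relation.Unary using (_⟨×⟩_; _∩_)
  open import Relation.Binary.PropositionalEquality

  open ModularArithmetic
  open CoprimePairs

  lookup-injective : ∀ {a} {A : Set a} {xs : List A} → Unique xs → ∀ i j → lookup xs i ≡ lookup xs j → i ≡ j
  lookup-injective (_ ∷ _)     zero    zero    _  = refl
  lookup-injective (x∉xs ∷ _)  zero    (suc j) eq = contradiction eq (All.lookup x∉xs (∈-lookup j))
  lookup-injective (x∉xs ∷ _)  (suc i) zero    eq = contradiction (sym eq) (All.lookup x∉xs (∈-lookup i))
  lookup-injective (_ ∷ uniq)  (suc i) (suc j) eq = cong suc (lookup-injective uniq i j eq)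

  coprimePairs-unique : ∀ S → Unique (coprimePairs S)
  coprimePairs-unique S = Unique.filter⁺ (uncurry coprime?) (Unique.cartesianProduct⁺ oneToS oneToS)
    where
    oneToS : Unique (applyDownFrom suc S)
    oneToS = Unique.applyDownFrom⁺₁ suc S (λ j<i _ 1+i≡1+j → ℕ.<⇒≢ j<i (sym (ℕ.suc-injective 1+i≡1+j)))

  coprime-cross-cancel : ∀ {a b a' b'} → 0 < a → Coprime a b → Coprime a' b' → a ℕ.* b' ≡ a' ℕ.* b → (a , b) ≡ (a' , b')
  coprime-cross-cancel {a} {b} {a'} {b'} 0<a coprime coprime' ab'≡a'b with ∣-antisym a∣a' a'∣a
    where
    ba'≡b'a : b ℕ.* a' ≡ b' ℕ.* a
    ba'≡b'a = trans (ℕ.*-comm b a') (trans (sym ab'≡a'b) (ℕ.*-comm a b'))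
    a∣a' : a ∣ a'
    a∣a' = coprime-divisor coprime (divides b' ba'≡b'a)
    a'∣a : a' ∣ a
    a'∣a = coprime-divisor coprime' (divides b (sym ba'≡b'a))
  ... | refl = cong (a ,_) (sym (ℕ.*-cancelˡ-≡ b' b a {{>-nonZero 0<a}} ab'≡a'b))

  rr-lastOne : ∀ p x y → rr p (suc (suc zero)) (x , y , 1ℤ) ≡ divp p x y
  rr-lastOne p x y = cong₂ (divp p) (divide-by-one x) (divide-by-one y)
    where
    divide-by-one : ∀ z → divp p z 1ℤ ≡ z
    divide-by-one z = trans (cong (z *_) (ℤ.^-zeroˡ (p ℕ.∸ 2))) (ℤ.*-identityʳ z)

  coefficients : (S : ℕ) → Fin (length (coprimePairs S)) → ℕ × ℕ
  coefficients S = lookup (coprimePairs S)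

  coefficients-properties : ∀ S j → ((InRange S ⟨×⟩ InRange S) ∩ uncurry Coprime) (coefficients S j)
  coefficients-properties S j = All.lookup properties (∈-lookup j)
    where
    properties : All ((InRange S ⟨×⟩ InRange S) ∩ uncurry Coprime) (coprimePairs S)
    properties = All.zip (All.filter⁺ (uncurry coprime?) (boundedPairs-inRange S) , All.all-filter (uncurry coprime?) (boundedPairs S))

  family : (S : ℕ) → Fin (length (coprimePairs S)) → Triple
  family S j = + proj₁ (coefficients S j) , + proj₂ (coefficients S j) , 1ℤ

  threshold : ℕ → ℕ
  threshold S = S ℕ.* S ℕ.+ (2 ℕ.* S ℕ.+ 2)

  threshold⇒S*S< : ∀ {S p} → p ≥ threshold S → S ℕ.* S < p
  threshold⇒S*S< {S} p≥ = ℕ.<-≤-trans (ℕ.m<m+n (S ℕ.* S) (ℕ.≤-trans (s≤s z≤n) (ℕ.m≤n+m 2 (2 ℕ.* S)))) p≥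

  threshold⇒2S+2≤ : ∀ {S p} → p ≥ threshold S → 2 ℕ.* S ℕ.+ 2 ≤ p
  threshold⇒2S+2≤ {S} p≥ = ℕ.≤-trans (ℕ.m≤n+m (2 ℕ.* S ℕ.+ 2) (S ℕ.* S)) p≥

  module _ (S : ℕ) {p : ℕ} (pr : Prime p) (p≥ : p ≥ threshold S) where

    open Congruence p

    private
      S*S<p : S ℕ.* S < p
      S*S<p = threshold⇒S*S< {S} p≥

      n : ℕ
      n = length (coprimePairs S)

      a b : Fin n → ℕ
      a j = proj₁ (coefficients S j)
      b j = proj₂ (coefficients S j)

      a-inRange : ∀ j → InRange S (a j)
      a-inRange j = proj₁ (proj₁ (coefficients-properties S j))

      b-inRange : ∀ j → InRange S (b j)
      b-inRange j = proj₂ (proj₁ (coefficients-properties S j))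

      coprime : ∀ j → Coprime (a j) (b j)
      coprime j = proj₂ (coefficients-properties S j)

      inRange<p : ∀ {c} → InRange S c → c < p
      inRange<p (0<c , c≤S) = ℕ.≤-<-trans (ℕ.≤-trans c≤S (ℕ.m≤m*n S S {{>-nonZero (ℕ.<-≤-trans 0<c c≤S)}})) S*S<p

      inRange-nonZero : ∀ {c} → InRange S c → NonZeroMod p (+ c)
      inRange-nonZero c∈S = nonZeroMod (proj₁ c∈S) (inRange<p c∈S)

      index-injective : ∀ {i j} → + a i ≈ + a j → + b i ≈ + b j → i ≡ j
      index-injective {i} {j} a≈ b≈ = lookup-injective (coprimePairs-unique S) i j
        (cong₂ _,_ (+≈+⇒≡ (inRange<p (a-inRange i)) (inRange<p (a-inRange j)) a≈)
                   (+≈+⇒≡ (inRange<p (b-inRange i)) (inRange<p (b-inRange j)) b≈))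

    family-isFamily : IsFamily p n (family S)
    family-isFamily = nonZeroCoefficients , notProportional
      where
      nonZeroCoefficients : ∀ j → NonZeroMod p (+ a j) × NonZeroMod p (+ b j) × NonZeroMod p 1ℤ
      nonZeroCoefficients j = inRange-nonZero (a-inRange j) , inRange-nonZero (b-inRange j)
                            , nonZeroMod (s≤s z≤n) (ℕ.nonTrivial⇒n>1 p {{prime⇒nonTrivial pr}})
      notProportional : ∀ i j → i ≢ j → ¬ Proportional p (family S i) (family S j)
      notProportional i j i≢j prop = i≢j (sym (index-injective (proj₁ aj≈ai×bj≈bi) (proj₂ aj≈ai×bj≈bi)))
        where
        aj≈ai×bj≈bi : + a j ≈ + a i × + b j ≈ + b i
        aj≈ai×bj≈bi = proportional-lastOne prop

    family-goodSet : GoodSet p n (family S) (suc (suc zero)) ⊤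
    family-goodSet j _ = inj₂ (inj₂ ratio-unique)
      where
      ratio-unique : UniqueIn p n ⊤ (λ i → rr p (suc (suc zero)) (family S i)) j
      ratio-unique i _ i≢j ratio≡ = i≢j (sym (lookup-injective (coprimePairs-unique S) j i
          (coprime-cross-cancel (proj₁ (a-inRange j)) (coprime j) (coprime i) cross≡)))
        where
        bound : ∀ k l → a k ℕ.* b l < p
        bound k l = ℕ.≤-<-trans (ℕ.*-mono-≤ (proj₂ (a-inRange k)) (proj₂ (b-inRange l))) S*S<p
        cross≈ : + a j * + b i ≈ + a i * + b j
        cross≈ = divp≈divp⇒cross≈ pr {+ a j} {+ a i} {b j} {b i}
                   (inRange-nonZero (b-inRange j)) (inRange-nonZero (b-inRange i))
                   (≡[]⇒≈ (subst₂ _≡[ p ]_ (rr-lastOne p (+ a j) (+ b j)) (rr-lastOne p (+ a i) (+ b i)) ratio≡))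
        cross≡ : a j ℕ.* b i ≡ a i ℕ.* b j
        cross≡ = +≈+⇒≡ (bound j i) (bound i j) (subst₂ _≈_ (sym (ℤ.pos-* (a j) (b i))) (sym (ℤ.pos-* (a i) (b j))) cross≈)

  below : ℕ → (p : ℕ) → Subset p
  below zero    _       = ⊥
  below (suc m) zero    = []
  below (suc m) (suc p) = inside ∷ below m p

  ∈below⇒< : ∀ {m p} {x : Fin p} → x ∈ below m p → toℕ x < m
  ∈below⇒< {zero}          x∈         = contradiction x∈ ∉⊥
  ∈below⇒< {suc m} {suc p} here       = s≤s z≤n
  ∈below⇒< {suc m} {suc p} (there x∈) = s≤s (∈below⇒< x∈)

  ∣below∣ : ∀ {m p} → m ≤ p → ∣ below m p ∣ ≡ m
  ∣below∣ {zero}  {p}     _         = ∣⊥∣≡0 p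
  ∣below∣ {suc m} {suc p} (s≤s m≤p) = cong suc (∣below∣ m≤p)

  positivesUpTo : ℕ → (p : ℕ) → Subset p
  positivesUpTo _ zero    = []
  positivesUpTo m (suc p) = outside ∷ below m p

  ∈positivesUpTo⇒ : ∀ {m p} {x : Fin p} → x ∈ positivesUpTo m p → 0 < toℕ x × toℕ x ≤ m
  ∈positivesUpTo⇒ {p = suc p} (there x∈) = s≤s z≤n , ∈below⇒< x∈

  ∣positivesUpTo∣ : ∀ {m p} → m < p → ∣ positivesUpTo m p ∣ ≡ m
  ∣positivesUpTo∣ {p = suc p} (s≤s m≤p) = ∣below∣ m≤p

  family-avoids : ∀ {p} S m → (2 ℕ.* S ℕ.+ 1) ℕ.* m < p → Avoids p (length (coprimePairs S)) (family S) (positivesUpTo m p)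
  family-avoids {p} S m small j x y z x∈ y∈ z∈ = subst (NonZeroMod p) (sym value≡) (nonZeroMod 0<V V<p)
    where
    open Congruence p
    A B X Y Z V : ℕ
    A = proj₁ (coefficients S j)
    B = proj₂ (coefficients S j)
    X = toℕ x
    Y = toℕ y
    Z = toℕ z
    V = A ℕ.* X ℕ.+ B ℕ.* Y ℕ.+ Z
    A≤S : A ≤ S
    A≤S = proj₂ (proj₁ (proj₁ (coefficients-properties S j)))
    B≤S : B ≤ S
    B≤S = proj₂ (proj₂ (proj₁ (coefficients-properties S j)))
    value≡ : + A * + X + + B * + Y + 1ℤ * + Z ≡ + V
    value≡ = sym (begin
      + (A ℕ.* X ℕ.+ B ℕ.* Y ℕ.+ Z)     ≡⟨ ℤ.pos-+ (A ℕ.* X ℕ.+ B ℕ.* Y) Z ⟩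
      + (A ℕ.* X ℕ.+ B ℕ.* Y) + + Z     ≡⟨ cong₂ _+_ (ℤ.pos-+ (A ℕ.* X) (B ℕ.* Y)) (ℤ.*-identityˡ (+ Z)) ⟨
      + (A ℕ.* X) + + (B ℕ.* Y) + 1ℤ * + Z ≡⟨ cong₂ (λ u v → u + v + 1ℤ * + Z) (ℤ.pos-* A X) (ℤ.pos-* B Y) ⟩
      + A * + X + + B * + Y + 1ℤ * + Z  ∎)
      where open ≡-Reasoning
    0<V : 0 < V
    0<V = ℕ.<-≤-trans (proj₁ (∈positivesUpTo⇒ z∈)) (ℕ.m≤n+m Z _)
    V<p : V < p
    V<p = ℕ.≤-<-trans (begin
      A ℕ.* X ℕ.+ B ℕ.* Y ℕ.+ Z ≤⟨ ℕ.+-mono-≤ (ℕ.+-mono-≤ (ℕ.*-mono-≤ A≤S (proj₂ (∈positivesUpTo⇒ x∈)))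
                                                        (ℕ.*-mono-≤ B≤S (proj₂ (∈positivesUpTo⇒ y∈))))
                                            (proj₂ (∈positivesUpTo⇒ z∈)) ⟩
      S ℕ.* m ℕ.+ S ℕ.* m ℕ.+ m ≡⟨ collect S m ⟩
      (2 ℕ.* S ℕ.+ 1) ℕ.* m     ∎) small
      where
      open ℕ.≤-Reasoning
      collect : ∀ S m → S ℕ.* m ℕ.+ S ℕ.* m ℕ.+ m ≡ (2 ℕ.* S ℕ.+ 1) ℕ.* m
      collect = solve-∀

  -- Products of normalised rationals do not compute, so the comparison is made in ℚᵘ,
  -- where it is an inequality between numerators.
  ℕ≤⇒ℚ≤ : ∀ P M N → P ℕ.* P ≤ 256 ℕ.* (M ℕ.* M ℕ.* N) →
    (+ 1 ℚ./ 16) ℚ.* (+ 1 ℚ./ 16) ℚ.* (+ P ℚ./ 1) ℚ.* (+ P ℚ./ 1) ℚ.≤ (+ M ℚ./ 1) ℚ.* (+ M ℚ./ 1) ℚ.* (+ N ℚ./ 1)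
  ℕ≤⇒ℚ≤ P M N bound = toℚᵘ-cancel-≤ (begin
    toℚᵘ (c ℚ.* c ℚ.* P' ℚ.* P')                  ≃⟨ toℚᵘ-homo-*₄ c c P' P' ⟩
    toℚᵘ c ℚᵘ.* toℚᵘ c ℚᵘ.* toℚᵘ P' ℚᵘ.* toℚᵘ P'  ≃⟨ ℚᵘ.*-cong (ℚᵘ.*-cong (ℚᵘ.*-cong (toℚᵘ-fromℚᵘ 1/16) (toℚᵘ-fromℚᵘ 1/16)) (toℚᵘ-fromℚᵘ (↑ P))) (toℚᵘ-fromℚᵘ (↑ P)) ⟩
    1/16 ℚᵘ.* 1/16 ℚᵘ.* ↑ P ℚᵘ.* ↑ P ≤⟨ *≤* (subst₂ ℤ._≤_ numeratorˡ numeratorʳ (ℤ.+≤+ bound)) ⟩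
    ↑ M ℚᵘ.* ↑ M ℚᵘ.* ↑ N ≃⟨ ℚᵘ.*-cong (ℚᵘ.*-cong (toℚᵘ-fromℚᵘ (↑ M)) (toℚᵘ-fromℚᵘ (↑ M))) (toℚᵘ-fromℚᵘ (↑ N)) ⟨
    toℚᵘ M' ℚᵘ.* toℚᵘ M' ℚᵘ.* toℚᵘ N'  ≃⟨ toℚᵘ-homo-*₃ M' M' N' ⟨
    toℚᵘ (M' ℚ.* M' ℚ.* N') ∎)
    where
    open ℚᵘ.≤-Reasoning
    ↑ : ℕ → ℚᵘ
    ↑ n = mkℚᵘ (+ n) 0
    1/16 : ℚᵘ
    1/16 = mkℚᵘ (+ 1) 15
    c P' M' N' : ℚ
    c = + 1 ℚ./ 16
    P' = + P ℚ./ 1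
    M' = + M ℚ./ 1
    N' = + N ℚ./ 1
    toℚᵘ-homo-*₃ : ∀ x y z → toℚᵘ (x ℚ.* y ℚ.* z) ℚᵘ.≃ toℚᵘ x ℚᵘ.* toℚᵘ y ℚᵘ.* toℚᵘ z
    toℚᵘ-homo-*₃ x y z = ℚᵘ.≃-trans (toℚᵘ-homo-* (x ℚ.* y) z) (ℚᵘ.*-congʳ (toℚᵘ-homo-* x y))
    toℚᵘ-homo-*₄ : ∀ w x y z → toℚᵘ (w ℚ.* x ℚ.* y ℚ.* z) ℚᵘ.≃ toℚᵘ w ℚᵘ.* toℚᵘ x ℚᵘ.* toℚᵘ y ℚᵘ.* toℚᵘ z
    toℚᵘ-homo-*₄ w x y z = ℚᵘ.≃-trans (toℚᵘ-homo-* (w ℚ.* x ℚ.* y) z) (ℚᵘ.*-congʳ (toℚᵘ-homo-*₃ w x y))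
    numeratorˡ : + (P ℕ.* P) ≡ (+ 1 ℤ.* + 1 ℤ.* + P ℤ.* + P) ℤ.* + 1
    numeratorˡ = trans (ℤ.pos-* P P) (arrange (+ P))
      where
      arrange : ∀ x → x ℤ.* x ≡ (+ 1 ℤ.* + 1 ℤ.* x ℤ.* x) ℤ.* + 1
      arrange = ℤ.solve-∀
    numeratorʳ : + (256 ℕ.* (M ℕ.* M ℕ.* N)) ≡ (+ M ℤ.* + M ℤ.* + N) ℤ.* + 256
    numeratorʳ = trans (ℤ.pos-* 256 (M ℕ.* M ℕ.* N))
                   (trans (cong (+ 256 ℤ.*_) (trans (ℤ.pos-* (M ℕ.* M) N) (cong (ℤ._* + N) (ℤ.pos-* M M))))
                          (ℤ.*-comm (+ 256) _))

  length-coprimePairs-≥ : ∀ k → length (coprimePairs (2 ℕ.* k)) ≥ k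
  length-coprimePairs-≥ zero = z≤n
  length-coprimePairs-≥ k@(suc _) = ℕ.≤-trans (ℕ.m≤m*n k k) (ℕ.*-cancelˡ-≤ 4 (begin
    4 ℕ.* (k ℕ.* k)              ≡⟨ square-double k ⟩
    2 ℕ.* k ℕ.* (2 ℕ.* k)        ≤⟨ length-coprimePairs (2 ℕ.* k) ⟩
    4 ℕ.* length (coprimePairs (2 ℕ.* k)) ∎))
    where
    open ℕ.≤-Reasoning
    square-double : ∀ k → 4 ℕ.* (k ℕ.* k) ≡ 2 ℕ.* k ℕ.* (2 ℕ.* k)
    square-double = solve-∀

  square-bound : ∀ {p S m n} → p ≤ 8 ℕ.* S ℕ.* m → S ℕ.* S ≤ 4 ℕ.* n → p ℕ.* p ≤ 256 ℕ.* (m ℕ.* m ℕ.* n)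
  square-bound {p} {S} {m} {n} p≤8Sm S²≤4n = begin
    p ℕ.* p                            ≤⟨ ℕ.*-mono-≤ p≤8Sm p≤8Sm ⟩
    8 ℕ.* S ℕ.* m ℕ.* (8 ℕ.* S ℕ.* m)  ≡⟨ regroup S m ⟩
    64 ℕ.* (S ℕ.* S) ℕ.* (m ℕ.* m)     ≤⟨ ℕ.*-monoˡ-≤ (m ℕ.* m) (ℕ.*-monoʳ-≤ 64 S²≤4n) ⟩
    64 ℕ.* (4 ℕ.* n) ℕ.* (m ℕ.* m)     ≡⟨ regroup' n m ⟩
    256 ℕ.* (m ℕ.* m ℕ.* n)            ∎
    where
    open ℕ.≤-Reasoning
    regroup : ∀ S m → 8 ℕ.* S ℕ.* m ℕ.* (8 ℕ.* S ℕ.* m) ≡ 64 ℕ.* (S ℕ.* S) ℕ.* (m ℕ.* m)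
    regroup = solve-∀
    regroup' : ∀ n m → 64 ℕ.* (4 ℕ.* n) ℕ.* (m ℕ.* m) ≡ 256 ℕ.* (m ℕ.* m ℕ.* n)
    regroup' = solve-∀

  module _ (S : ℕ) {p : ℕ} (1≤S : 1 ≤ S) (p≥ : p ≥ threshold S) where

    private
      d : ℕ
      d = 2 ℕ.* S ℕ.+ 2
      d≤p : d ≤ p
      d≤p = threshold⇒2S+2≤ {S} p≥
      instance _ = >-nonZero (ℕ.<-≤-trans (s≤s z≤n) (ℕ.m≤n+m 2 (2 ℕ.* S)))
      m : ℕ
      m = p / d
      m*d≤p : m ℕ.* d ≤ p
      m*d≤p = m/n*n≤m p d
      0<m : 0 < m
      0<m = m≥n⇒m/n>0 d≤p

      [2S+1]m<p : (2 ℕ.* S ℕ.+ 1) ℕ.* m < p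
      [2S+1]m<p = begin-strict
        (2 ℕ.* S ℕ.+ 1) ℕ.* m      <⟨ ℕ.*-monoˡ-< m {{>-nonZero 0<m}} (ℕ.n<1+n (2 ℕ.* S ℕ.+ 1)) ⟩
        suc (2 ℕ.* S ℕ.+ 1) ℕ.* m  ≡⟨ cong (ℕ._* m) (ℕ.+-suc (2 ℕ.* S) 1) ⟨
        d ℕ.* m                    ≡⟨ ℕ.*-comm d m ⟩
        m ℕ.* d                    ≤⟨ m*d≤p ⟩
        p                          ∎
        where open ℕ.≤-Reasoning

      p≤8Sm : p ≤ 8 ℕ.* S ℕ.* m
      p≤8Sm = ℕ.<⇒≤ (begin-strict
        p                             ≡⟨ m≡m%n+[m/n]*n p d ⟩
        p % d ℕ.+ m ℕ.* d             <⟨ ℕ.+-monoˡ-< (m ℕ.* d) (m%n<n p d) ⟩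
        suc m ℕ.* d                   ≤⟨ ℕ.*-monoˡ-≤ d (ℕ.+-monoˡ-≤ m 0<m) ⟩
        (m ℕ.+ m) ℕ.* d               ≡⟨ expand m S ⟩
        4 ℕ.* (S ℕ.* m) ℕ.+ 4 ℕ.* m   ≤⟨ ℕ.+-monoʳ-≤ (4 ℕ.* (S ℕ.* m)) (ℕ.*-monoʳ-≤ 4 m≤S*m) ⟩
        4 ℕ.* (S ℕ.* m) ℕ.+ 4 ℕ.* (S ℕ.* m) ≡⟨ collect S m ⟩
        8 ℕ.* S ℕ.* m                 ∎)
        where
        open ℕ.≤-Reasoning
        expand : ∀ m S → (m ℕ.+ m) ℕ.* (2 ℕ.* S ℕ.+ 2) ≡ 4 ℕ.* (S ℕ.* m) ℕ.+ 4 ℕ.* m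
        expand = solve-∀
        m≤S*m : m ≤ S ℕ.* m
        m≤S*m = ℕ.m≤n*m m S {{>-nonZero 1≤S}}
        collect : ∀ S m → 4 ℕ.* (S ℕ.* m) ℕ.+ 4 ℕ.* (S ℕ.* m) ≡ 8 ℕ.* S ℕ.* m
        collect = solve-∀

    large-avoiding-set : Σ (Subset p) λ A → Avoids p (length (coprimePairs S)) (family S) A
                           × p ℕ.* p ≤ 256 ℕ.* (∣ A ∣ ℕ.* ∣ A ∣ ℕ.* length (coprimePairs S))
    large-avoiding-set = positivesUpTo m p , family-avoids S m [2S+1]m<p ,
      subst (λ M → p ℕ.* p ≤ 256 ℕ.* (M ℕ.* M ℕ.* length (coprimePairs S))) (sym (∣positivesUpTo∣ m<p))
            (square-bound {p} {S} {m} p≤8Sm (length-coprimePairs S))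
      where
      m<p : m < p
      m<p = ℕ.≤-<-trans (ℕ.m≤n*m m (2 ℕ.* S ℕ.+ 1) {{>-nonZero (ℕ.m≤n+m 1 (2 ℕ.* S))}}) [2S+1]m<p

open import Defs
open import Data.Nat using (ℕ; _≥_)
open import Data.Nat.Primality using (Prime)
open import Data.Integer using (+_)
open import Data.Rational using (ℚ; 0ℚ; _<_; _≤_; _*_; _/_)
open import Data.Fin using (Fin)
open import Data.Fin.Subset using (Subset; ∣_∣)
open import Data.Product using (Σ; _×_)

import Data.Nat as ℕ
import Data.Nat.Properties as ℕ
open import Data.Rational using (1ℚ)
open import Data.Rational.Properties using (positive⁻¹; ≤-reflexive; *-identityˡ)
open import Data.Fin using (zero; suc)
open import Data.Fin.Subset using (⊤)
open import Data.Fin.Subset.Properties using (∣⊤∣≡n)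
open import Data.List using (length)
open import Data.Product using (_,_; map₂)
open import Relation.Binary.PropositionalEquality using (subst; sym)
open CoprimePairs using (coprimePairs)
open Construction

proposition9 : Σ ℚ λ c₁ → Σ ℚ λ c₂ → (0ℚ < c₁) × (0ℚ < c₂) ×
  ((k : ℕ) → k ≥ 1 →
    Σ ℕ λ n → Σ (Fin n → Triple) λ E → Σ ℕ λ p₀ →
      ((p : ℕ) → Prime p → p ≥ p₀ →
        IsFamily p n E
        × (Σ (Fin 3) λ i → Σ (Subset n) λ J → GoodSet p n E i J × (c₁ * ((+ n) / 1) ≤ (+ ∣ J ∣) / 1))
        × n ≥ k
        × (Σ (Subset p) λ A → Avoids p n E A
            × (c₂ * c₂ * ((+ p) / 1) * ((+ p) / 1) ≤ ((+ ∣ A ∣) / 1) * ((+ ∣ A ∣) / 1) * ((+ n) / 1)))))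
proposition9 = 1ℚ , + 1 / 16 , positive⁻¹ 1ℚ , positive⁻¹ (+ 1 / 16) , λ k k≥1 →
  length (coprimePairs (2 ℕ.* k)) , family (2 ℕ.* k) , threshold (2 ℕ.* k) , λ p pr p≥ →
    family-isFamily (2 ℕ.* k) pr p≥
  , (suc (suc zero) , ⊤ , family-goodSet (2 ℕ.* k) pr p≥ , full-density (length (coprimePairs (2 ℕ.* k))))
  , length-coprimePairs-≥ k
  , map₂ (λ {A} → map₂ (ℕ≤⇒ℚ≤ p ∣ A ∣ _)) (large-avoiding-set (2 ℕ.* k) (ℕ.≤-trans k≥1 (ℕ.m≤n*m k 2)) p≥)
  where
  full-density : ∀ n → 1ℚ * (+ n / 1) ≤ + ∣ ⊤ {n} ∣ / 1
  full-density n = subst (λ J → 1ℚ * (+ n / 1) ≤ + J / 1) (sym (∣⊤∣≡n n)) (≤-reflexive (*-identityˡ _))
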